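{- For distinct integers $n,m\ge 2$, $\chi'_L(K_{n,m})=\max\{n,m\}+1$. For every integer $n\ge 2$, $\chi'_L(K_{n,n})=n+2$.
   Context: $K_{n,m}$ is the complete bipartite graph with parts of sizes $n$ and $m$. For a proper edge coloring $c:E(G)\to\{1,\dots,k\}$ of a connected graph $G$, let $\pi=(\mathcal{C}_1,\dots,\mathcal{C}_k)$ be the ordered partition of $E(G)$ into color classes. For a vertex $v$ and an edge $e=xy$, $d(v,e)=\min\{d(v,x),d(v,y)\}$, and $d(v,\mathcal{C}_i)=\min\{d(v,e): e\in\mathcal{C}_i\}$. The edge color code of $v$ is $c_\pi(v)=(d(v,\mathcal{C}_1),\dots,d(v,\mathcal{C}_k))$. The coloring $c$ is an edge-locating coloring if distinct vertices have distinct edge color codes; $\chi'_L(G)$ is the minimum $k$ for which $G$ has an edge-locating coloring with $k$ colors. -}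

module Defs where

open import Data.Nat using (ℕ; zero; suc; _⊓_; _<_)
open import Data.Bool using (Bool; true; false; _∧_; _∨_; if_then_else_; _xor_)
open import Data.Fin using (Fin; splitAt)
open import Data.Fin.Properties using (_≟_)
open import Data.List using (List; foldr; cartesianProduct)
open import Data.Bool.ListAction using (any)
open import Data.List.Base using (allFin)
open import Data.Product using (_×_; _,_; Σ; ∃; proj₁; proj₂)
open import Data.Sum using (_⊎_; inj₁; inj₂; isInj₁)
open import Data.Maybe using (is-just)
open import Relation.Nullary using (¬_)
open import Relation.Nullary.Decidable using (isYes)
open import Relation.Binary.PropositionalEquality using (_≡_; _≢_)

record Graph : Set where
  field
    N   : ℕ
    adj : Fin N → Fin N → Bool
open Graph public

-- Complete bipartite graph K_{n,m}: vertices Fin (n + m); the first n form one part,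
-- the last m the other; two vertices are adjacent iff they lie in different parts.
inFirst : ∀ n m → Fin (n Data.Nat.+ m) → Bool
inFirst n m v with splitAt n v
... | inj₁ _ = true
... | inj₂ _ = false

K : ℕ → ℕ → Graph
K n m = record { N = n Data.Nat.+ m ; adj = λ u v → inFirst n m u xor inFirst n m v }

module _ (G : Graph) where
  private
    V = Fin (N G)

  reach : ℕ → V → V → Bool
  reach zero u v = isYes (u ≟ v)
  reach (suc k) u v = reach k u v ∨ any (λ w → reach k u w ∧ adj G w v) (allFin (N G))

  -- least k < b with p k (or b if none)
  leastBelow : (ℕ → Bool) → ℕ → ℕ
  leastBelow p zero = zero
  leastBelow p (suc b) = if p zero then zero else suc (leastBelow (λ k → p (suc k)) b)

  -- graph distance d(u,v) (shortest walk length; exact for connected graphs, as any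
  -- two vertices are then joined by a walk of length < N)
  dist : V → V → ℕ
  dist u v = leastBelow (λ k → reach k u v) (N G)

  -- An edge coloring with k colors: a color for every (ordered) adjacent pair
  -- (values on non-adjacent pairs are irrelevant).
  Coloring : ℕ → Set
  Coloring k = V → V → Fin k

  -- c is a proper edge coloring of G using exactly the colors 1..k (all classes nonempty)
  IsProperEdgeColoring : ∀ {k} → Coloring k → Set
  IsProperEdgeColoring {k} c =
      (∀ x y → adj G x y ≡ true → c x y ≡ c y x)
    × (∀ x y z → adj G x y ≡ true → adj G x z ≡ true → y ≢ z → c x y ≢ c x z)
    × (∀ (i : Fin k) → ∃ λ x → ∃ λ y → adj G x y ≡ true × c x y ≡ i)

  distClass : ∀ {k} → Coloring k → V → Fin k → ℕ
  distClass {k} c v i =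
    foldr (λ p acc → if adj G (proj₁ p) (proj₂ p) ∧ isYes (c (proj₁ p) (proj₂ p) ≟ i)
                     then (dist v (proj₁ p) ⊓ dist v (proj₂ p)) ⊓ acc else acc)
          (N G)
          (cartesianProduct (allFin (N G)) (allFin (N G)))

  code : ∀ {k} → Coloring k → V → Fin k → ℕ
  code c v i = distClass c v i

  IsEdgeLocatingColoring : ∀ {k} → Coloring k → Set
  IsEdgeLocatingColoring c =
    IsProperEdgeColoring c × (∀ u v → (∀ i → code c u i ≡ code c v i) → u ≡ v)

  HasELC : ℕ → Set
  HasELC k = Σ (Coloring k) IsEdgeLocatingColoring

  EdgeLocatingChromaticIndex : ℕ → Set
  EdgeLocatingChromaticIndex k = HasELC k × (∀ j → j < k → ¬ HasELC j)

{-# OPTIONS --safe #-}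

-- In K_{p,q} every vertex is adjacent to an end of every edge, so the code of a vertex is 0 at the
-- colours of its incident edges and 1 elsewhere: a proper colouring is locating iff distinct vertices
-- see distinct sets of colours. With k ≤ q colours each left vertex sees all k colours on its q edges,
-- so two left vertices get the same code; with p = q = n and n + 1 colours each vertex misses exactly
-- one colour, and 2n vertices cannot all miss different ones.
-- The colourings achieving the bounds are cyclic Latin rectangles (a, b) ↦ a + g(b) mod k. For p ≠ q,
-- with k = max(p, q) + 1 and g = id, row a sees the cyclic interval of length q starting at a and
-- column b the one of length p starting at b; such an interval determines its start and its length.
-- For p = q = n, with k = n + 2 and g taking the values 0, 2, 3, …, n, columns still see intervals of
-- length n, while row a sees every colour except a ± 1, a set with a one-point hole that no interval has.
module Submission where

open import Data.Bool using (Bool; true; false; _∧_; _∨_; if_then_else_)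
open import Data.Bool.ListAction using (any)
open import Data.Bool.Properties using (∨-zeroʳ; T-≡) renaming (_≟_ to _≟ᵇ_)
open import Data.Empty using (⊥-elim)
open import Data.Fin using (Fin; zero; suc; splitAt; _↑ˡ_; _↑ʳ_; toℕ; fromℕ<; punchOut)
open import Data.Fin.Properties
  using ( _≟_; splitAt-↑ˡ; splitAt-↑ʳ; splitAt⁻¹-↑ˡ; splitAt⁻¹-↑ʳ; ↑ˡ-injective; ↑ʳ-injective
        ; any?; all?; ¬∀⟶∃¬; pigeonhole; injective⇒≤; punchOut-injective
        ; toℕ-injective; toℕ-fromℕ<; toℕ<n )
open import Data.List using ([]; _∷_; foldr; cartesianProduct; allFin)
open import Data.List.Membership.Propositional using (_∈_; lose)
open import Data.List.Membership.Propositional.Properties using (∈-cartesianProduct⁺; ∈-allFin)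
open import Data.List.Relation.Unary.Any using (here; there)
open import Data.List.Relation.Unary.Any.Properties using (any⁺)
open import Data.Nat
  using (ℕ; zero; suc; _+_; _∸_; _≤_; _<_; _<?_; _⊓_; _⊔_; z≤n; s≤s; s≤s⁻¹; NonZero; >-nonZero⁻¹)
open import Data.Nat.DivMod
  using (_%_; _mod_; %-distribˡ-+; m%n%n≡m%n; [m+n]%n≡m%n; m<n⇒m%n≡m; m%n<n)
open import Data.Nat.Properties
  using ( ≤-refl; ≤-trans; ≤-antisym; ≤-total; <⇒≤; <-irrefl; <-trans; <-≤-trans; ≤-<-trans
        ; ≮⇒≥; ≤∧≢⇒<; n≤0⇒n≡0; n<1+n; 1+n≰n; m≤n⇒m<n∨m≡n; suc-injective
        ; +-comm; +-assoc; +-suc; +-identityʳ; +-cancelʳ-≡; m+1+n≢m; m≤m+n; m+[n∸m]≡n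
        ; +-monoˡ-≤; +-monoʳ-≤; m⊓n≤m; m⊓n≤n; ⊓-glb
        ; m≤m⊔n; m≤n⊔m; ⊔-lub; ⊔-idem; m≤n⇒m⊔n≡n; m≥n⇒m⊔n≡m; +-distribˡ-⊔
        ; module ≤-Reasoning )
  renaming (_≟_ to _≟ℕ_)
open import Data.Product using (_×_; _,_; ∃; proj₁; proj₂)
open import Data.Sum using (_⊎_; inj₁; inj₂)
open import Function using (_∘_)
open import Function.Bundles using (Equivalence)
open import Function.Definitions using (Injective; StrictlySurjective)
open import Level using (0ℓ)
open import Relation.Binary.PropositionalEquality
open import Relation.Nullary using (¬_; Dec; yes; no; contradiction)
open import Relation.Nullary.Decidable using (isYes; _×-dec_)
open import Relation.Unary using (Pred; _⊆_; _≐_)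
open import Relation.Unary.Properties using (≐-sym; ≐-trans)

open import Defs

≐-transport : ∀ {A : Set} {P P′ Q Q′ : Pred A 0ℓ} → P ≐ P′ → Q ≐ Q′ → P ≐ Q → P′ ≐ Q′
≐-transport P≐P′ Q≐Q′ P≐Q = ≐-trans (≐-sym P≐P′) (≐-trans P≐Q Q≐Q′)

module _ (G : Graph) where

  leastBelow-≤ : ∀ b (p : ℕ → Bool) {k} → k < b → p k ≡ true → leastBelow G p b ≤ k
  leastBelow-≤ (suc b) p {zero} _ pk rewrite pk = z≤n
  leastBelow-≤ (suc b) p {suc k} (s≤s k<b) pk with p zero
  ... | true = z≤n
  ... | false = s≤s (leastBelow-≤ b (p ∘ suc) k<b pk)

  leastBelow-pos : ∀ b (p : ℕ → Bool) → 0 < b → p 0 ≡ false → 0 < leastBelow G p b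
  leastBelow-pos (suc b) p _ p0 rewrite p0 = s≤s z≤n

  reach-0-refl : ∀ u → reach G 0 u u ≡ true
  reach-0-refl u = cong isYes (≡-≟-identity _≟_ refl)

  reach-1-adj : ∀ {u v} → adj G u v ≡ true → reach G 1 u v ≡ true
  reach-1-adj {u} {v} uv = trans (cong (reach G 0 u v ∨_) some-step) (∨-zeroʳ _)
    where
    step : reach G 0 u u ∧ adj G u v ≡ true
    step rewrite reach-0-refl u = uv
    some-step : any (λ w → reach G 0 u w ∧ adj G w v) (allFin (N G)) ≡ true
    some-step = Equivalence.to T-≡ (any⁺ _ (lose (∈-allFin u) (Equivalence.from T-≡ step)))

  dist-refl : ∀ u → 0 < N G → dist G u u ≡ 0
  dist-refl u 0<N = n≤0⇒n≡0 (leastBelow-≤ (N G) (λ k → reach G k u u) 0<N (reach-0-refl u))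

  dist-adj : ∀ {u v} → 1 < N G → adj G u v ≡ true → dist G u v ≤ 1
  dist-adj {u} {v} 1<N uv = leastBelow-≤ (N G) (λ k → reach G k u v) 1<N (reach-1-adj uv)

  dist-pos : ∀ {u v} → 0 < N G → u ≢ v → 0 < dist G u v
  dist-pos {u} {v} 0<N u≢v =
    leastBelow-pos (N G) (λ k → reach G k u v) 0<N (cong isYes (≢-≟-identity _≟_ u≢v))

  module _ {k} (c : Coloring G k) (v : Fin (N G)) (i : Fin k) where
    private
      Edge = Fin (N G) × Fin (N G)

      inClass : Edge → Bool
      inClass e = adj G (proj₁ e) (proj₂ e) ∧ isYes (c (proj₁ e) (proj₂ e) ≟ i)

      distEdge : Edge → ℕ
      distEdge e = dist G v (proj₁ e) ⊓ dist G v (proj₂ e)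

      step : Edge → ℕ → ℕ
      step e acc = if inClass e then distEdge e ⊓ acc else acc

      fold-≤ : ∀ {e} es b → e ∈ es → inClass e ≡ true → foldr step b es ≤ distEdge e
      fold-≤ (e ∷ es) b (here refl) e∈C rewrite e∈C = m⊓n≤m (distEdge e) _
      fold-≤ (e′ ∷ es) b (there e∈es) e∈C with inClass e′
      ... | true = ≤-trans (m⊓n≤n (distEdge e′) _) (fold-≤ es b e∈es e∈C)
      ... | false = fold-≤ es b e∈es e∈C

      fold-pos : ∀ es b → 0 < b → (∀ e → inClass e ≡ true → 0 < distEdge e) → 0 < foldr step b es
      fold-pos [] b 0<b _ = 0<b
      fold-pos (e ∷ es) b 0<b far with inClass e in e∈C
      ... | true = ⊓-glb (far e e∈C) (fold-pos es b 0<b far)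
      ... | false = fold-pos es b 0<b far

      inClass⇒adj : ∀ {x y} → inClass (x , y) ≡ true → adj G x y ≡ true
      inClass⇒adj {x} {y} e∈C with adj G x y
      ... | true = refl
      ... | false = e∈C

      inClass⇒colour : ∀ {x y} → inClass (x , y) ≡ true → c x y ≡ i
      inClass⇒colour {x} {y} e∈C with adj G x y | c x y ≟ i
      ... | true | yes xy∈C = xy∈C
      inClass⇒colour () | true | no _
      inClass⇒colour () | false | _

    distClass-≤ : ∀ {x y} → adj G x y ≡ true → c x y ≡ i → distClass G c v i ≤ dist G v x ⊓ dist G v y
    distClass-≤ {x} {y} xy cxy≡i =
      fold-≤ (cartesianProduct (allFin (N G)) (allFin (N G))) (N G)
             (∈-cartesianProduct⁺ (∈-allFin x) (∈-allFin y)) xy∈C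
      where
      xy∈C : inClass (x , y) ≡ true
      xy∈C rewrite xy | cxy≡i = cong isYes (≡-≟-identity _≟_ refl)

    distClass-pos : 0 < N G → (∀ x y → adj G x y ≡ true → c x y ≡ i → 0 < dist G v x ⊓ dist G v y) →
                    0 < distClass G c v i
    distClass-pos 0<N far =
      fold-pos (cartesianProduct (allFin (N G)) (allFin (N G))) (N G) 0<N
               (λ e e∈C → far (proj₁ e) (proj₂ e) (inClass⇒adj e∈C) (inClass⇒colour e∈C))

  Seen : ∀ {k} → Coloring G k → Fin (N G) → Pred (Fin k) 0ℓ
  Seen c v i = ∃ λ w → adj G v w ≡ true × c v w ≡ i

module EdgeDominated (G : Graph)
    (adj-sym : ∀ x y → adj G x y ≡ adj G y x)
    (dominating : ∀ v {x y} → adj G x y ≡ true → adj G v x ≡ true ⊎ adj G v y ≡ true)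
    (1<N : 1 < N G) where

  private
    0<N : 0 < N G
    0<N = <⇒≤ 1<N

  module _ {k} (c : Coloring G k) where

    seen? : ∀ v i → Dec (Seen G c v i)
    seen? v i = any? (λ w → (adj G v w ≟ᵇ true) ×-dec (c v w ≟ i))

    code-seen : ∀ {v i} → Seen G c v i → code G c v i ≡ 0
    code-seen {v} {i} (w , vw , cvw≡i) = n≤0⇒n≡0 (begin
      distClass G c v i        ≤⟨ distClass-≤ G c v i vw cvw≡i ⟩
      dist G v v ⊓ dist G v w  ≤⟨ m⊓n≤m _ _ ⟩
      dist G v v               ≡⟨ dist-refl G v 0<N ⟩
      0                        ∎)
      where open ≤-Reasoning

    code-unseen : IsProperEdgeColoring G c → ∀ {v i} → ¬ Seen G c v i → code G c v i ≡ 1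
    code-unseen (c-sym , _ , onto) {v} {i} unseen =
      ≤-antisym upper (distClass-pos G c v i 0<N far)
      where
      x = proj₁ (onto i)
      y = proj₁ (proj₂ (onto i))
      xy = proj₁ (proj₂ (proj₂ (onto i)))
      cxy≡i = proj₂ (proj₂ (proj₂ (onto i)))

      upper : distClass G c v i ≤ 1
      upper with dominating v xy
      ... | inj₁ vx = ≤-trans (distClass-≤ G c v i xy cxy≡i) (≤-trans (m⊓n≤m _ _) (dist-adj G 1<N vx))
      ... | inj₂ vy = ≤-trans (distClass-≤ G c v i xy cxy≡i) (≤-trans (m⊓n≤n _ _) (dist-adj G 1<N vy))

      far : ∀ x y → adj G x y ≡ true → c x y ≡ i → 0 < dist G v x ⊓ dist G v y
      far x y xy cxy≡i = ⊓-glb (dist-pos G 0<N v≢x) (dist-pos G 0<N v≢y)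
        where
        v≢x : v ≢ x
        v≢x refl = unseen (y , xy , cxy≡i)
        v≢y : v ≢ y
        v≢y refl = unseen (x , trans (adj-sym v x) xy , trans (sym (c-sym x v xy)) cxy≡i)

    module _ (proper : IsProperEdgeColoring G c) where

      sameCode⇒sameSeen : ∀ {u v} → (∀ i → code G c u i ≡ code G c v i) → Seen G c u ≐ Seen G c v
      sameCode⇒sameSeen {u} {v} same = transfer same , transfer (sym ∘ same)
        where
        transfer : ∀ {u v} → (∀ i → code G c u i ≡ code G c v i) → Seen G c u ⊆ Seen G c v
        transfer {u} {v} same {i} su with seen? v i
        ... | yes sv = sv
        ... | no ¬sv with trans (sym (code-seen su)) (trans (same i) (code-unseen proper ¬sv))
        ... | ()

      sameSeen⇒sameCode : ∀ {u v} → Seen G c u ≐ Seen G c v → ∀ i → code G c u i ≡ code G c v i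
      sameSeen⇒sameCode {u} {v} (u⊆v , v⊆u) i with seen? u i
      ... | yes su = trans (code-seen su) (sym (code-seen (u⊆v su)))
      ... | no ¬su = trans (code-unseen proper ¬su) (sym (code-unseen proper (¬su ∘ v⊆u)))

missing⇒≤ : ∀ {d j} {h : Fin d → Fin (suc j)} {i} →
            Injective _≡_ _≡_ h → (∀ x → h x ≢ i) → d ≤ j
missing⇒≤ h-inj miss = injective⇒≤ (h-inj ∘ punchOut-injective (miss _ ∘ sym) (miss _ ∘ sym))

injective⇒surjective : ∀ {d j} {h : Fin d → Fin j} →
                       j ≤ d → Injective _≡_ _≡_ h → StrictlySurjective _≡_ h
injective⇒surjective {j = suc _} {h} j≤d h-inj i with any? (λ x → h x ≟ i)
... | yes hit = hit
... | no ¬hit = ⊥-elim (1+n≰n (≤-trans j≤d (missing⇒≤ h-inj (λ x hx≡i → ¬hit (x , hx≡i)))))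

injective-image-missesOne : ∀ {d} {h : Fin d → Fin (suc d)} → Injective _≡_ _≡_ h →
                            ∃ λ i → (λ j → ∃ λ x → h x ≡ j) ≐ (_≢ i)
injective-image-missesOne {d} {h} h-inj with all? (λ i → any? (λ x → h x ≟ i))
... | yes onto = ⊥-elim (1+n≰n (injective⇒≤ {f = proj₁ ∘ onto} preimage-inj))
  where
  preimage-inj : Injective _≡_ _≡_ (proj₁ ∘ onto)
  preimage-inj {i} {i′} eq = trans (sym (proj₂ (onto i))) (trans (cong h eq) (proj₂ (onto i′)))
... | no ¬onto with ¬∀⟶∃¬ (suc d) _ (λ i → any? (λ x → h x ≟ i)) ¬onto
... | i , ¬hit = i , (λ (x , hx≡j) j≡i → ¬hit (x , trans hx≡j j≡i)) , others
  where
  miss : ∀ x → h x ≢ i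
  miss x hx≡i = ¬hit (x , hx≡i)

  others : ∀ {j} → j ≢ i → ∃ λ x → h x ≡ j
  others j≢i with injective⇒surjective ≤-refl
                    (h-inj ∘ punchOut-injective (miss _ ∘ sym) (miss _ ∘ sym))
                    (punchOut (j≢i ∘ sym))
  ... | x , eq = x , punchOut-injective (miss x ∘ sym) (j≢i ∘ sym) eq

module Cyclic (k : ℕ) .{{_ : NonZero k}} where

  infixl 6 _⊕_ _⊖_

  _⊕_ : ℕ → ℕ → Fin k
  c ⊕ x = (c + x) mod k

  -- (i − c) mod k, as long as c ≤ k
  _⊖_ : Fin k → ℕ → ℕ
  i ⊖ c = (toℕ i + (k ∸ c)) % k

  -- the cyclic interval c, c + 1, …, c + L − 1
  Arc : ℕ → ℕ → Pred (Fin k) 0ℓ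
  Arc c L i = i ⊖ c < L

  open ≡-Reasoning

  private
    %-absorbˡ : ∀ m n → (m % k + n) % k ≡ (m + n) % k
    %-absorbˡ m n = begin
      (m % k + n) % k          ≡⟨ %-distribˡ-+ (m % k) n k ⟩
      (m % k % k + n % k) % k  ≡⟨ cong (λ t → (t + n % k) % k) (m%n%n≡m%n m k) ⟩
      (m % k + n % k) % k      ≡⟨ %-distribˡ-+ m n k ⟨
      (m + n) % k              ∎

    %-absorbʳ : ∀ m n → (m + n % k) % k ≡ (m + n) % k
    %-absorbʳ m n = begin
      (m + n % k) % k  ≡⟨ cong (_% k) (+-comm m (n % k)) ⟩
      (n % k + m) % k  ≡⟨ %-absorbˡ n m ⟩
      (n + m) % k      ≡⟨ cong (_% k) (+-comm n m) ⟩
      (m + n) % k      ∎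

    +-complement : ∀ {c} x → c ≤ k → c + x + (k ∸ c) ≡ x + k
    +-complement {c} x c≤k = begin
      c + x + (k ∸ c)    ≡⟨ cong (_+ (k ∸ c)) (+-comm c x) ⟩
      x + c + (k ∸ c)    ≡⟨ +-assoc x c (k ∸ c) ⟩
      x + (c + (k ∸ c))  ≡⟨ cong (x +_) (m+[n∸m]≡n c≤k) ⟩
      x + k              ∎

  toℕ-⊕ : ∀ c x → toℕ (c ⊕ x) ≡ (c + x) % k
  toℕ-⊕ c x = toℕ-fromℕ< (m%n<n (c + x) k)

  toℕ-⊕-< : ∀ c x → c + x < k → toℕ (c ⊕ x) ≡ c + x
  toℕ-⊕-< c x c+x<k = trans (toℕ-⊕ c x) (m<n⇒m%n≡m c+x<k)

  ⊖<k : ∀ i c → i ⊖ c < k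
  ⊖<k i c = m%n<n (toℕ i + (k ∸ c)) k

  ⊕-comm : ∀ c x → c ⊕ x ≡ x ⊕ c
  ⊕-comm c x = cong (_mod k) (+-comm c x)

  ⊕-suc : ∀ c x c′ x′ → c ⊕ x ≡ c′ ⊕ x′ → c ⊕ suc x ≡ c′ ⊕ suc x′
  ⊕-suc c x c′ x′ eq = toℕ-injective (begin
    toℕ (c ⊕ suc x)         ≡⟨ toℕ-⊕ c (suc x) ⟩
    (c + suc x) % k         ≡⟨ cong (_% k) (+-suc c x) ⟩
    (1 + (c + x)) % k       ≡⟨ %-absorbʳ 1 (c + x) ⟨
    (1 + (c + x) % k) % k   ≡⟨ cong (λ t → (1 + t) % k) (c+x≡c′+x′) ⟩
    (1 + (c′ + x′) % k) % k ≡⟨ %-absorbʳ 1 (c′ + x′) ⟩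
    (1 + (c′ + x′)) % k     ≡⟨ cong (_% k) (+-suc c′ x′) ⟨
    (c′ + suc x′) % k       ≡⟨ toℕ-⊕ c′ (suc x′) ⟨
    toℕ (c′ ⊕ suc x′)       ∎)
    where
    c+x≡c′+x′ : (c + x) % k ≡ (c′ + x′) % k
    c+x≡c′+x′ = trans (sym (toℕ-⊕ c x)) (trans (cong toℕ eq) (toℕ-⊕ c′ x′))

  ⊕-+k : ∀ c x → c ⊕ (x + k) ≡ c ⊕ x
  ⊕-+k c x = toℕ-injective (begin
    toℕ (c ⊕ (x + k))  ≡⟨ toℕ-⊕ c (x + k) ⟩
    (c + (x + k)) % k  ≡⟨ cong (_% k) (+-assoc c x k) ⟨
    (c + x + k) % k    ≡⟨ [m+n]%n≡m%n (c + x) k ⟩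
    (c + x) % k        ≡⟨ toℕ-⊕ c x ⟨
    toℕ (c ⊕ x)        ∎)

  ⊕-⊖ : ∀ {c x} → c ≤ k → x < k → c ⊕ x ⊖ c ≡ x
  ⊕-⊖ {c} {x} c≤k x<k = begin
    (toℕ (c ⊕ x) + (k ∸ c)) % k  ≡⟨ cong (λ t → (t + (k ∸ c)) % k) (toℕ-⊕ c x) ⟩
    ((c + x) % k + (k ∸ c)) % k  ≡⟨ %-absorbˡ (c + x) (k ∸ c) ⟩
    (c + x + (k ∸ c)) % k        ≡⟨ cong (_% k) (+-complement x c≤k) ⟩
    (x + k) % k                  ≡⟨ [m+n]%n≡m%n x k ⟩
    x % k                        ≡⟨ m<n⇒m%n≡m x<k ⟩
    x                            ∎

  ⊖-⊕ : ∀ {c} i → c ≤ k → c ⊕ (i ⊖ c) ≡ i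
  ⊖-⊕ {c} i c≤k = toℕ-injective (begin
    toℕ (c ⊕ (i ⊖ c))                   ≡⟨ toℕ-⊕ c (i ⊖ c) ⟩
    (c + (toℕ i + (k ∸ c)) % k) % k     ≡⟨ %-absorbʳ c (toℕ i + (k ∸ c)) ⟩
    (c + (toℕ i + (k ∸ c))) % k         ≡⟨ cong (_% k) (sym (+-assoc c (toℕ i) (k ∸ c))) ⟩
    (c + toℕ i + (k ∸ c)) % k           ≡⟨ cong (_% k) (+-complement (toℕ i) c≤k) ⟩
    (toℕ i + k) % k                     ≡⟨ [m+n]%n≡m%n (toℕ i) k ⟩
    toℕ i % k                           ≡⟨ m<n⇒m%n≡m (toℕ<n i) ⟩
    toℕ i                               ∎)

  ⊕-cancelˡ : ∀ {c x y} → c ≤ k → x < k → y < k → c ⊕ x ≡ c ⊕ y → x ≡ y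
  ⊕-cancelˡ {c} c≤k x<k y<k eq = trans (sym (⊕-⊖ c≤k x<k)) (trans (cong (_⊖ c) eq) (⊕-⊖ c≤k y<k))

  private
    0<k : 0 < k
    0<k = >-nonZero⁻¹ k

  toℕ-⊕0 : ∀ {c} → c < k → toℕ (c ⊕ 0) ≡ c
  toℕ-⊕0 {c} c<k = trans (toℕ-⊕-< c 0 (subst (_< k) (sym (+-identityʳ c)) c<k)) (+-identityʳ c)

  Arc-⊕ : ∀ {c x L} → c ≤ k → x < k → x < L → Arc c L (c ⊕ x)
  Arc-⊕ {L = L} c≤k x<k x<L = subst (_< L) (sym (⊕-⊖ c≤k x<k)) x<L

  arc-⊆⇒≤ : ∀ {c L M} → c ≤ k → L ≤ k → Arc c L ⊆ Arc c M → L ≤ M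
  arc-⊆⇒≤ c≤k L≤k L⊆M = ≮⇒≥ λ M<L →
    <-irrefl (⊕-⊖ c≤k (<-≤-trans M<L L≤k)) (L⊆M (Arc-⊕ c≤k (<-≤-trans M<L L≤k) M<L))

  -- The predecessor of c lies in Arc c′ M unless c = c′, but it is never in Arc c L since L < k.
  arc-start-unique : ∀ {c c′ L M} → 0 < L → L < k → c < k → c′ < k → Arc c L ≐ Arc c′ M → c ≡ c′
  arc-start-unique {c} {c′} {L} 0<L L<k c<k c′<k (L⊆M , M⊆L)
    with c ⊕ 0 ⊖ c′ in s≡ | L⊆M (Arc-⊕ (<⇒≤ c<k) 0<k 0<L)
  ... | zero | _ = trans (sym (toℕ-⊕0 c<k)) (trans (cong toℕ c⊕0≡c′⊕s) (toℕ-⊕0 c′<k))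
    where
    c⊕0≡c′⊕s : c ⊕ 0 ≡ c′ ⊕ 0
    c⊕0≡c′⊕s = trans (sym (⊖-⊕ (c ⊕ 0) (<⇒≤ c′<k))) (cong (c′ ⊕_) s≡)
  ... | suc s | s<M = contradiction (⊕-cancelˡ (<⇒≤ c<k) (≤-<-trans t<L L<k) 0<k c⊕1+t≡c⊕0) λ ()
    where
    s<k : s < k
    s<k = <-trans (n<1+n s) (subst (_< k) s≡ (⊖<k (c ⊕ 0) c′))
    t = c′ ⊕ s ⊖ c
    t<L : t < L
    t<L = M⊆L (Arc-⊕ (<⇒≤ c′<k) s<k (<-trans (n<1+n s) s<M))
    c⊕1+t≡c⊕0 : c ⊕ suc t ≡ c ⊕ 0
    c⊕1+t≡c⊕0 = trans (⊕-suc c t c′ s (⊖-⊕ (c′ ⊕ s) (<⇒≤ c<k)))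
                  (trans (cong (c′ ⊕_) (sym s≡)) (⊖-⊕ (c ⊕ 0) (<⇒≤ c′<k)))

  arc-injective : ∀ {c c′ L M} → 0 < L → L < k → M < k → c < k → c′ < k →
                  Arc c L ≐ Arc c′ M → c ≡ c′ × L ≡ M
  arc-injective 0<L L<k M<k c<k c′<k L≐M with arc-start-unique 0<L L<k c<k c′<k L≐M
  ... | refl = refl , ≤-antisym (arc-⊆⇒≤ (<⇒≤ c<k) (<⇒≤ L<k) (proj₁ L≐M))
                                (arc-⊆⇒≤ (<⇒≤ c<k) (<⇒≤ M<k) (proj₂ L≐M))

  arc-convex : ∀ {c L c′ x} → suc L < k → c ≤ k →
               Arc c L (c′ ⊕ x) → Arc c L (c′ ⊕ suc (suc x)) → Arc c L (c′ ⊕ suc x)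
  arc-convex {c} {L} {c′} {x} 1+L<k c≤k x∈ 2+x∈ with suc (c′ ⊕ x ⊖ c) <? L
  ... | yes 1+t<L = subst (Arc c L) 1+x≡ (Arc-⊕ c≤k (<-trans 1+t<L (<-trans (n<1+n L) 1+L<k)) 1+t<L)
    where 1+x≡ = ⊕-suc c _ c′ x (⊖-⊕ (c′ ⊕ x) c≤k)
  ... | no 1+t≮L = contradiction (<-trans (n<1+n _) (subst (_< L) (⊕-⊖ c≤k (≤-<-trans (s≤s x∈) 1+L<k))
                                                       (subst (Arc c L) (sym 2+x≡) 2+x∈))) 1+t≮L
    where 2+x≡ = ⊕-suc c _ c′ (suc x) (⊕-suc c _ c′ x (⊖-⊕ (c′ ⊕ x) c≤k))

module Bipartite (p q : ℕ) where

  V : Set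
  V = Fin (p + q)

  left : Fin p → V
  left a = a ↑ˡ q

  right : Fin q → V
  right b = p ↑ʳ b

  data PartView : V → Set where
    inLeft  : ∀ a → PartView (left a)
    inRight : ∀ b → PartView (right b)

  partView : ∀ v → PartView v
  partView v with splitAt p v in eq
  ... | inj₁ a = subst PartView (splitAt⁻¹-↑ˡ eq) (inLeft a)
  ... | inj₂ b = subst PartView (splitAt⁻¹-↑ʳ eq) (inRight b)

  inFirst-left : ∀ a → inFirst p q (left a) ≡ true
  inFirst-left a with splitAt p (left a) | splitAt-↑ˡ p a q
  ... | .(inj₁ a) | refl = refl

  inFirst-right : ∀ b → inFirst p q (right b) ≡ false
  inFirst-right b with splitAt p (right b) | splitAt-↑ʳ p q b
  ... | .(inj₂ b) | refl = refl

  adj-left-right : ∀ a b → adj (K p q) (left a) (right b) ≡ true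
  adj-left-right a b rewrite inFirst-left a | inFirst-right b = refl

  adj-right-left : ∀ a b → adj (K p q) (right b) (left a) ≡ true
  adj-right-left a b rewrite inFirst-left a | inFirst-right b = refl

  left-left-nonadjacent : ∀ a a′ → adj (K p q) (left a) (left a′) ≢ true
  left-left-nonadjacent a a′ rewrite inFirst-left a | inFirst-left a′ = λ ()

  right-right-nonadjacent : ∀ b b′ → adj (K p q) (right b) (right b′) ≢ true
  right-right-nonadjacent b b′ rewrite inFirst-right b | inFirst-right b′ = λ ()

  adj-sym : ∀ x y → adj (K p q) x y ≡ adj (K p q) y x
  adj-sym x y with inFirst p q x | inFirst p q y
  ... | true  | true  = refl
  ... | true  | false = refl
  ... | false | true  = refl
  ... | false | false = refl

  adj-dominating : ∀ v {x y} → adj (K p q) x y ≡ true → adj (K p q) v x ≡ true ⊎ adj (K p q) v y ≡ true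
  adj-dominating v {x} {y} xy with inFirst p q v | inFirst p q x | inFirst p q y
  ... | true  | true  | false = inj₂ refl
  ... | true  | false | _     = inj₁ refl
  ... | false | true  | _     = inj₁ refl
  ... | false | false | true  = inj₂ refl
  adj-dominating v () | true  | true  | true
  adj-dominating v () | false | false | false

  module _ {k} (c : Coloring (K p q) k) where

    rowColours : Fin p → Fin q → Fin k
    rowColours a b = c (left a) (right b)

    columnColours : Fin q → Fin p → Fin k
    columnColours b a = c (right b) (left a)

    Seen-left : ∀ a → Seen (K p q) c (left a) ≐ (λ i → ∃ λ b → rowColours a b ≡ i)
    Seen-left a = to , λ (b , cab≡i) → right b , adj-left-right a b , cab≡i
      where
      to : Seen (K p q) c (left a) ⊆ (λ i → ∃ λ b → rowColours a b ≡ i)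
      to (w , aw , caw≡i) with partView w
      ... | inRight b = b , caw≡i
      ... | inLeft a′ = ⊥-elim (left-left-nonadjacent a a′ aw)

    Seen-right : ∀ b → Seen (K p q) c (right b) ≐ (λ i → ∃ λ a → columnColours b a ≡ i)
    Seen-right b = to , λ (a , cba≡i) → left a , adj-right-left a b , cba≡i
      where
      to : Seen (K p q) c (right b) ⊆ (λ i → ∃ λ a → columnColours b a ≡ i)
      to (w , bw , cbw≡i) with partView w
      ... | inLeft a = a , cbw≡i
      ... | inRight b′ = ⊥-elim (right-right-nonadjacent b b′ bw)

    module _ (proper : IsProperEdgeColoring (K p q) c) where

      rowColours-injective : ∀ a → Injective _≡_ _≡_ (rowColours a)
      rowColours-injective a {b} {b′} eq with b ≟ b′
      ... | yes b≡b′ = b≡b′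
      ... | no b≢b′ = ⊥-elim (proj₁ (proj₂ proper) (left a) (right b) (right b′)
                         (adj-left-right a b) (adj-left-right a b′) (b≢b′ ∘ ↑ʳ-injective p b b′) eq)

      columnColours-injective : ∀ b → Injective _≡_ _≡_ (columnColours b)
      columnColours-injective b {a} {a′} eq with a ≟ a′
      ... | yes a≡a′ = a≡a′
      ... | no a≢a′ = ⊥-elim (proj₁ (proj₂ proper) (right b) (left a) (left a′)
                         (adj-right-left a b) (adj-right-left a′ b) (a≢a′ ∘ ↑ˡ-injective q a a′) eq)

  Seen-left-missesOne : (c : Coloring (K p q) (suc q)) → IsProperEdgeColoring (K p q) c →
                        ∀ a → ∃ λ i → Seen (K p q) c (left a) ≐ (_≢ i)
  Seen-left-missesOne c proper a with injective-image-missesOne (rowColours-injective c proper a)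
  ... | i , image≐ = i , ≐-trans (Seen-left c a) image≐

  Seen-right-missesOne : (c : Coloring (K p q) (suc p)) → IsProperEdgeColoring (K p q) c →
                         ∀ b → ∃ λ i → Seen (K p q) c (right b) ≐ (_≢ i)
  Seen-right-missesOne c proper b with injective-image-missesOne (columnColours-injective c proper b)
  ... | i , image≐ = i , ≐-trans (Seen-right c b) image≐

  module _ (1<p+q : 1 < p + q) where
    open EdgeDominated (K p q) adj-sym adj-dominating 1<p+q

    leftVertices-identified : ∀ {k} → HasELC (K p q) k → k ≤ q → ∀ a a′ → a ≡ a′
    leftVertices-identified (c , proper , locating) k≤q a a′ =
      ↑ˡ-injective q a a′ (locating (left a) (left a′)
        (sameSeen⇒sameCode c proper ((λ _ → seesAll a′) , (λ _ → seesAll a))))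
      where
      seesAll : ∀ a {i} → Seen (K p q) c (left a) i
      seesAll a {i} = proj₂ (Seen-left c a) (injective⇒surjective k≤q (rowColours-injective c proper a) i)

    rightVertices-identified : ∀ {k} → HasELC (K p q) k → k ≤ p → ∀ b b′ → b ≡ b′
    rightVertices-identified (c , proper , locating) k≤p b b′ =
      ↑ʳ-injective p b b′ (locating (right b) (right b′)
        (sameSeen⇒sameCode c proper ((λ _ → seesAll b′) , (λ _ → seesAll b))))
      where
      seesAll : ∀ b {i} → Seen (K p q) c (right b) i
      seesAll b {i} = proj₂ (Seen-right c b) (injective⇒surjective k≤p (columnColours-injective c proper b) i)

  module _ {k} (F : Fin p → Fin q → Fin k) where

    RowSet : Fin p → Pred (Fin k) 0ℓ
    RowSet a i = ∃ λ b → F a b ≡ i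

    ColumnSet : Fin q → Pred (Fin k) 0ℓ
    ColumnSet b i = ∃ λ a → F a b ≡ i

  module LatinRectangle {k} (F : Fin p → Fin q → Fin (suc k))
      (rows-injective : ∀ a → Injective _≡_ _≡_ (F a))
      (columns-injective : ∀ b → Injective _≡_ _≡_ (λ a → F a b))
      (onto : ∀ i → ∃ λ a → ∃ λ b → F a b ≡ i) where

    colourParts : Fin p ⊎ Fin q → Fin p ⊎ Fin q → Fin (suc k)
    colourParts (inj₁ a) (inj₂ b) = F a b
    colourParts (inj₂ b) (inj₁ a) = F a b
    colourParts _        _        = zero

    colouring : Coloring (K p q) (suc k)
    colouring u v = colourParts (splitAt p u) (splitAt p v)

    colouring-left-right : ∀ a b → colouring (left a) (right b) ≡ F a b
    colouring-left-right a b = cong₂ colourParts (splitAt-↑ˡ p a q) (splitAt-↑ʳ p q b)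

    colouring-right-left : ∀ a b → colouring (right b) (left a) ≡ F a b
    colouring-right-left a b = cong₂ colourParts (splitAt-↑ʳ p q b) (splitAt-↑ˡ p a q)

    colouring-proper : IsProperEdgeColoring (K p q) colouring
    colouring-proper = symmetric , distinct , λ i → surjective (onto i)
      where
      symmetric : ∀ x y → adj (K p q) x y ≡ true → colouring x y ≡ colouring y x
      symmetric x y xy with partView x | partView y
      ... | inLeft a  | inRight b = trans (colouring-left-right a b) (sym (colouring-right-left a b))
      ... | inRight b | inLeft a  = trans (colouring-right-left a b) (sym (colouring-left-right a b))
      ... | inLeft a  | inLeft a′  = ⊥-elim (left-left-nonadjacent a a′ xy)
      ... | inRight b | inRight b′ = ⊥-elim (right-right-nonadjacent b b′ xy)

      distinct : ∀ x y z → adj (K p q) x y ≡ true → adj (K p q) x z ≡ true → y ≢ z →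
                 colouring x y ≢ colouring x z
      distinct x y z xy xz y≢z eq with partView x | partView y | partView z
      ... | inLeft a | inRight b | inRight b′ =
            y≢z (cong right (rows-injective a (trans (sym (colouring-left-right a b))
                                                (trans eq (colouring-left-right a b′)))))
      ... | inRight b | inLeft a | inLeft a′ =
            y≢z (cong left (columns-injective b (trans (sym (colouring-right-left a b))
                                                   (trans eq (colouring-right-left a′ b)))))
      ... | inLeft a  | inLeft a′  | _          = left-left-nonadjacent a a′ xy
      ... | inLeft a  | inRight _  | inLeft a′  = left-left-nonadjacent a a′ xz
      ... | inRight b | inRight b′ | _          = right-right-nonadjacent b b′ xy
      ... | inRight b | inLeft _   | inRight b′ = right-right-nonadjacent b b′ xz

      surjective : ∀ {i} → (∃ λ a → ∃ λ b → F a b ≡ i) →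
                   ∃ λ x → ∃ λ y → adj (K p q) x y ≡ true × colouring x y ≡ i
      surjective (a , b , Fab≡i) =
        left a , right b , adj-left-right a b , trans (colouring-left-right a b) Fab≡i

    Seen-left-colouring : ∀ a → Seen (K p q) colouring (left a) ≐ RowSet F a
    Seen-left-colouring a = ≐-trans (Seen-left colouring a)
      ( (λ (b , eq) → b , trans (sym (colouring-left-right a b)) eq)
      , (λ (b , eq) → b , trans (colouring-left-right a b) eq))

    Seen-right-colouring : ∀ b → Seen (K p q) colouring (right b) ≐ ColumnSet F b
    Seen-right-colouring b = ≐-trans (Seen-right colouring b)
      ( (λ (a , eq) → a , trans (sym (colouring-right-left a b)) eq)
      , (λ (a , eq) → a , trans (colouring-right-left a b) eq))

    module _ (1<p+q : 1 < p + q)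
        (rows-separated : ∀ a a′ → RowSet F a ≐ RowSet F a′ → a ≡ a′)
        (columns-separated : ∀ b b′ → ColumnSet F b ≐ ColumnSet F b′ → b ≡ b′)
        (rows-columns-separated : ∀ a b → ¬ RowSet F a ≐ ColumnSet F b) where
      open EdgeDominated (K p q) adj-sym adj-dominating 1<p+q

      colouring-locating : ∀ u v → (∀ i → code (K p q) colouring u i ≡ code (K p q) colouring v i) → u ≡ v
      colouring-locating u v same
        with partView u | partView v | sameCode⇒sameSeen colouring colouring-proper same
      ... | inLeft a | inLeft a′ | u≐v = cong left (rows-separated a a′
            (≐-transport (Seen-left-colouring a) (Seen-left-colouring a′) u≐v))
      ... | inRight b | inRight b′ | u≐v = cong right (columns-separated b b′
            (≐-transport (Seen-right-colouring b) (Seen-right-colouring b′) u≐v))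
      ... | inLeft a | inRight b | u≐v = ⊥-elim (rows-columns-separated a b
            (≐-transport (Seen-left-colouring a) (Seen-right-colouring b) u≐v))
      ... | inRight b | inLeft a | u≐v = ⊥-elim (rows-columns-separated a b
            (≐-transport (Seen-left-colouring a) (Seen-right-colouring b) (≐-sym u≐v)))

      colouring-hasELC : HasELC (K p q) (suc k)
      colouring-hasELC = colouring , colouring-proper , colouring-locating

  module CyclicRectangle (k : ℕ) (p≤1+k : p ≤ suc k)
      (g : Fin q → ℕ) (g<1+k : ∀ b → g b < suc k) (g-injective : Injective _≡_ _≡_ g) where
    open Cyclic (suc k)

    F : Fin p → Fin q → Fin (suc k)
    F a b = toℕ a ⊕ g b

    private
      a<1+k : ∀ a → toℕ a < suc k
      a<1+k a = <-≤-trans (toℕ<n a) p≤1+k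

      g≤1+k : ∀ b → g b ≤ suc k
      g≤1+k b = <⇒≤ (g<1+k b)

    rows-injective : ∀ a → Injective _≡_ _≡_ (F a)
    rows-injective a eq = g-injective (⊕-cancelˡ (<⇒≤ (a<1+k a)) (g<1+k _) (g<1+k _) eq)

    columns-injective : ∀ b → Injective _≡_ _≡_ (λ a → F a b)
    columns-injective b {a} {a′} eq = toℕ-injective (⊕-cancelˡ (g≤1+k b) (a<1+k a) (a<1+k a′)
      (trans (⊕-comm (g b) (toℕ a)) (trans eq (⊕-comm (toℕ a′) (g b)))))

    RowSet-F : ∀ a → RowSet F a ≐ (λ i → ∃ λ b → g b ≡ i ⊖ toℕ a)
    RowSet-F a = (λ (b , eq) → b , trans (sym (⊕-⊖ (<⇒≤ (a<1+k a)) (g<1+k b))) (cong (_⊖ toℕ a) eq))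
               , (λ {i} (b , eq) → b , trans (cong (toℕ a ⊕_) eq) (⊖-⊕ i (<⇒≤ (a<1+k a))))

    ColumnSet-F : ∀ b → ColumnSet F b ≐ Arc (g b) p
    ColumnSet-F b = to , from
      where
      to : ColumnSet F b ⊆ Arc (g b) p
      to {i} (a , eq) = subst (_< p) (begin
        toℕ a              ≡⟨ ⊕-⊖ (g≤1+k b) (a<1+k a) ⟨
        g b ⊕ toℕ a ⊖ g b  ≡⟨ cong (_⊖ g b) (trans (⊕-comm (g b) (toℕ a)) eq) ⟩
        i ⊖ g b            ∎) (toℕ<n a)
        where open ≡-Reasoning

      from : Arc (g b) p ⊆ ColumnSet F b
      from {i} i∈arc = fromℕ< i∈arc ,
        trans (cong (_⊕ g b) (toℕ-fromℕ< i∈arc)) (trans (⊕-comm _ (g b)) (⊖-⊕ i (g≤1+k b)))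

    F-reaches : ∀ a b {i} → toℕ a + g b ≡ toℕ i → ∃ λ a → ∃ λ b → F a b ≡ i
    F-reaches a b {i} a+b≡i = a , b ,
      toℕ-injective (trans (toℕ-⊕-< (toℕ a) (g b) (subst (_< suc k) (sym a+b≡i) (toℕ<n i))) a+b≡i)

module _ (n : ℕ) where
  open Bipartite n n

  missedColour : (c : Coloring (K n n) (suc n)) → IsProperEdgeColoring (K n n) c →
                 ∀ v → ∃ λ i → Seen (K n n) c v ≐ (_≢ i)
  missedColour c proper v with partView v
  ... | inLeft a  = Seen-left-missesOne c proper a
  ... | inRight b = Seen-right-missesOne c proper b

  square-noELC : 2 ≤ n → ¬ HasELC (K n n) (suc n)
  square-noELC 2≤n (c , proper , locating) with pigeonhole (+-monoˡ-≤ n 2≤n) (proj₁ ∘ missedColour c proper)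
  ... | u , v , u<v , same = <-irrefl (cong toℕ (locating u v (sameSeen⇒sameCode c proper u≐v))) u<v
    where
    open EdgeDominated (K n n) adj-sym adj-dominating (≤-trans 2≤n (m≤m+n n n))
    u≐v : Seen (K n n) c u ≐ Seen (K n n) c v
    u≐v = ≐-trans (proj₂ (missedColour c proper u))
            (≐-sym (subst (λ i → Seen (K n n) c v ≐ (_≢ i)) (sym same) (proj₂ (missedColour c proper v))))

sum-split : ∀ {p q i} → 0 < p → 0 < q → suc i < p + q →
            ∃ λ (a : Fin p) → ∃ λ (b : Fin q) → toℕ a + toℕ b ≡ i
sum-split {suc zero}     {i = i}     _ _   (s≤s i<q) = zero , fromℕ< i<q , toℕ-fromℕ< i<q
sum-split {suc (suc p)}  {i = zero}  _ 0<q _         = zero , fromℕ< 0<q , toℕ-fromℕ< 0<q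
sum-split {suc (suc p)}  {i = suc i} _ 0<q (s≤s 2+i<p+q) with sum-split (s≤s z≤n) 0<q 2+i<p+q
... | a , b , a+b≡i = suc a , b , cong suc a+b≡i

2+⊔≤+ : ∀ {p q} → 2 ≤ p → 2 ≤ q → 2 + (p ⊔ q) ≤ p + q
2+⊔≤+ {p} {q} 2≤p 2≤q = subst (_≤ p + q) (sym (+-distribˡ-⊔ 2 p q))
  (⊔-lub (subst (_≤ p + q) (+-comm p 2) (+-monoʳ-≤ p 2≤q)) (+-monoˡ-≤ q 2≤p))

module DistinctSizes (p q : ℕ) (2≤p : 2 ≤ p) (2≤q : 2 ≤ q) (p≢q : p ≢ q) where
  open Bipartite p q
  open Cyclic (suc (p ⊔ q))

  private
    p<1+k : p < suc (p ⊔ q)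
    p<1+k = s≤s (m≤m⊔n p q)

    q<1+k : q < suc (p ⊔ q)
    q<1+k = s≤s (m≤n⊔m p q)

  open CyclicRectangle (p ⊔ q) (<⇒≤ p<1+k) toℕ (λ b → <-trans (toℕ<n b) q<1+k) toℕ-injective

  RowSet-arc : ∀ a → RowSet F a ≐ Arc (toℕ a) q
  RowSet-arc a = ≐-trans (RowSet-F a)
    ((λ (b , b≡x) → subst (_< q) b≡x (toℕ<n b)) , λ x<q → fromℕ< x<q , toℕ-fromℕ< x<q)

  F-onto : ∀ i → ∃ λ a → ∃ λ b → F a b ≡ i
  F-onto i with sum-split (<-trans (s≤s z≤n) 2≤p) (<-trans (s≤s z≤n) 2≤q)
                  (<-≤-trans (s≤s (toℕ<n i)) (2+⊔≤+ 2≤p 2≤q))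
  ... | a , b , a+b≡i = F-reaches a b a+b≡i

  hasELC : HasELC (K p q) (suc (p ⊔ q))
  hasELC = LatinRectangle.colouring-hasELC F rows-injective columns-injective F-onto
    (≤-trans 2≤p (m≤m+n p q)) rows-separated columns-separated rows-columns-separated
    where
    toℕ<1+k : ∀ {r} → r < suc (p ⊔ q) → (x : Fin r) → toℕ x < suc (p ⊔ q)
    toℕ<1+k r<1+k x = <-trans (toℕ<n x) r<1+k

    rows-separated : ∀ a a′ → RowSet F a ≐ RowSet F a′ → a ≡ a′
    rows-separated a a′ a≐a′ = toℕ-injective (proj₁ (arc-injective (<-trans (s≤s z≤n) 2≤q) q<1+k q<1+k
      (toℕ<1+k p<1+k a) (toℕ<1+k p<1+k a′) (≐-transport (RowSet-arc a) (RowSet-arc a′) a≐a′)))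

    columns-separated : ∀ b b′ → ColumnSet F b ≐ ColumnSet F b′ → b ≡ b′
    columns-separated b b′ b≐b′ = toℕ-injective (proj₁ (arc-injective (<-trans (s≤s z≤n) 2≤p) p<1+k p<1+k
      (toℕ<1+k q<1+k b) (toℕ<1+k q<1+k b′) (≐-transport (ColumnSet-F b) (ColumnSet-F b′) b≐b′)))

    rows-columns-separated : ∀ a b → ¬ RowSet F a ≐ ColumnSet F b
    rows-columns-separated a b a≐b = p≢q (sym (proj₂ (arc-injective (<-trans (s≤s z≤n) 2≤q) q<1+k p<1+k
      (toℕ<1+k p<1+k a) (toℕ<1+k q<1+k b) (≐-transport (RowSet-arc a) (ColumnSet-F b) a≐b))))

-- Offsets 0, 2, 3, …, m: the row of a in the square colouring then misses exactly the colours a ± 1.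
skipOne : ∀ {m} → Fin m → ℕ
skipOne zero    = 0
skipOne (suc b) = 2 + toℕ b

skipOne-≤ : ∀ {m} (b : Fin m) → skipOne b ≤ m
skipOne-≤ zero    = z≤n
skipOne-≤ (suc b) = s≤s (toℕ<n b)

skipOne-injective : ∀ {m} → Injective _≡_ _≡_ (skipOne {m})
skipOne-injective {x = zero}  {zero}  _  = refl
skipOne-injective {x = suc b} {suc b′} eq = cong suc (toℕ-injective (suc-injective (suc-injective eq)))

skipOne-≢1 : ∀ {m} (b : Fin m) → skipOne b ≢ 1
skipOne-≢1 zero    ()
skipOne-≢1 (suc b) ()

skipOne-≢1+m : ∀ {m} (b : Fin m) → skipOne b ≢ suc m
skipOne-≢1+m zero    ()
skipOne-≢1+m (suc b) eq = <-irrefl (suc-injective (suc-injective eq)) (toℕ<n b)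

skipOne-image : ∀ {m x} → 0 < m → x < 2 + m → x ≢ 1 → x ≢ suc m → ∃ λ (b : Fin m) → skipOne b ≡ x
skipOne-image {suc m} {zero}        _ _                 _   _     = zero , refl
skipOne-image {suc m} {suc zero}    _ _                 x≢1 _     = contradiction refl x≢1
skipOne-image {suc m} {suc (suc y)} _ (s≤s (s≤s y<1+m)) _   x≢1+m =
  suc (fromℕ< y<m) , cong (2 +_) (toℕ-fromℕ< y<m)
  where
  y<m : y < m
  y<m = ≤∧≢⇒< (s≤s⁻¹ y<1+m) (x≢1+m ∘ cong (2 +_))

module SquareSizes (n : ℕ) (2≤n : 2 ≤ n) where
  open Bipartite n n
  open Cyclic (2 + n)

  private
    0<n : 0 < n
    0<n = <-trans (s≤s z≤n) 2≤n

    n<2+n : n < 2 + n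
    n<2+n = <-trans (n<1+n n) (n<1+n (suc n))

    a<2+n : ∀ (a : Fin n) → toℕ a < 2 + n
    a<2+n a = <-trans (toℕ<n a) n<2+n

    a+1<2+n : ∀ (a : Fin n) → toℕ a + 1 < 2 + n
    a+1<2+n a = subst (_< 2 + n) (+-comm 1 (toℕ a)) (s≤s (<-trans (toℕ<n a) (n<1+n n)))

    a+2<2+n : ∀ (a : Fin n) → toℕ a + 2 < 2 + n
    a+2<2+n a = subst (_< 2 + n) (+-comm 2 (toℕ a)) (s≤s (s≤s (toℕ<n a)))

    skipOne<2+n : ∀ (b : Fin n) → skipOne b < 2 + n
    skipOne<2+n b = ≤-<-trans (skipOne-≤ b) n<2+n

    2≢1+n : 2 ≢ suc n
    2≢1+n 2≡1+n = 1+n≰n (subst (2 ≤_) (suc-injective (sym 2≡1+n)) 2≤n)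

  open CyclicRectangle (suc n) (<⇒≤ n<2+n) skipOne skipOne<2+n skipOne-injective
  open ≡-Reasoning

  ⊖-⊕-row : ∀ a i → toℕ a ⊕ (i ⊖ toℕ a) ≡ i
  ⊖-⊕-row a i = ⊖-⊕ i (<⇒≤ (a<2+n a))

  RowSet-gaps : ∀ a → RowSet F a ≐ (λ i → i ⊖ toℕ a ≢ 1 × i ⊖ toℕ a ≢ suc n)
  RowSet-gaps a = ≐-trans (RowSet-F a)
    ( (λ (b , b≡x) → skipOne-≢1 b ∘ trans b≡x , skipOne-≢1+m b ∘ trans b≡x)
    , (λ {i} (x≢1 , x≢1+n) → skipOne-image 0<n (⊖<k i (toℕ a)) x≢1 x≢1+n))

  offset-inRow : ∀ a {x} → x < 2 + n → x ≢ 1 → x ≢ suc n → RowSet F a (toℕ a ⊕ x)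
  offset-inRow a x<2+n x≢1 x≢1+n = proj₂ (RowSet-gaps a)
    (subst (λ y → y ≢ 1 × y ≢ suc n) (sym (⊕-⊖ (<⇒≤ (a<2+n a)) x<2+n)) (x≢1 , x≢1+n))

  offset1-notInRow : ∀ a → ¬ RowSet F a (toℕ a ⊕ 1)
  offset1-notInRow a a⊕1∈a =
    proj₁ (proj₁ (RowSet-gaps a) a⊕1∈a) (⊕-⊖ (<⇒≤ (a<2+n a)) (s≤s (s≤s z≤n)))

  -- Row a misses a ⊕ 1, hence so does row a′: a ⊕ 1 is a′ ⊕ 1 or a′ ⊕ (n + 1), i.e. a′ ⊖ 1.
  row-shift : ∀ a a′ → RowSet F a′ ⊆ RowSet F a → toℕ a′ ≡ toℕ a ⊎ toℕ a′ ≡ toℕ a + 2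
  row-shift a a′ a′⊆a with toℕ a ⊕ 1 ⊖ toℕ a′ ≟ℕ 1 | toℕ a ⊕ 1 ⊖ toℕ a′ ≟ℕ suc n
  ... | yes x≡1 | _ = inj₁ (+-cancelʳ-≡ 1 (toℕ a′) (toℕ a) (begin
    toℕ a′ + 1        ≡⟨ toℕ-⊕-< (toℕ a′) 1 (a+1<2+n a′) ⟨
    toℕ (toℕ a′ ⊕ 1)  ≡⟨ cong toℕ (subst (λ x → toℕ a′ ⊕ x ≡ toℕ a ⊕ 1) x≡1 (⊖-⊕-row a′ (toℕ a ⊕ 1))) ⟩
    toℕ (toℕ a ⊕ 1)   ≡⟨ toℕ-⊕-< (toℕ a) 1 (a+1<2+n a) ⟩
    toℕ a + 1         ∎))
  ... | no _ | yes x≡1+n = inj₂ (begin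
    toℕ a′                      ≡⟨ toℕ-⊕0 (a<2+n a′) ⟨
    toℕ (toℕ a′ ⊕ 0)            ≡⟨ cong toℕ (⊕-+k (toℕ a′) 0) ⟨
    toℕ (toℕ a′ ⊕ suc (suc n))  ≡⟨ cong toℕ (⊕-suc (toℕ a′) (suc n) (toℕ a) 1 a′⊕1+n≡a⊕1) ⟩
    toℕ (toℕ a ⊕ 2)             ≡⟨ toℕ-⊕-< (toℕ a) 2 (a+2<2+n a) ⟩
    toℕ a + 2                   ∎)
    where
    a′⊕1+n≡a⊕1 : toℕ a′ ⊕ suc n ≡ toℕ a ⊕ 1
    a′⊕1+n≡a⊕1 = subst (λ x → toℕ a′ ⊕ x ≡ toℕ a ⊕ 1) x≡1+n (⊖-⊕-row a′ (toℕ a ⊕ 1))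
  ... | no x≢1 | no x≢1+n = ⊥-elim (offset1-notInRow a (a′⊆a (proj₂ (RowSet-gaps a′) (x≢1 , x≢1+n))))

  rows-separated : ∀ a a′ → RowSet F a ≐ RowSet F a′ → a ≡ a′
  rows-separated a a′ (a⊆a′ , a′⊆a) with row-shift a a′ a′⊆a | row-shift a′ a a⊆a′
  ... | inj₁ a′≡a | _ = toℕ-injective (sym a′≡a)
  ... | inj₂ _ | inj₁ a≡a′ = toℕ-injective a≡a′
  ... | inj₂ a′≡a+2 | inj₂ a≡a′+2 =
        ⊥-elim (m+1+n≢m (toℕ a) (sym (trans a≡a′+2 (trans (cong (_+ 2) a′≡a+2) (+-assoc (toℕ a) 2 2)))))

  columns-separated : ∀ b b′ → ColumnSet F b ≐ ColumnSet F b′ → b ≡ b′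
  columns-separated b b′ b≐b′ = skipOne-injective (proj₁ (arc-injective 0<n n<2+n n<2+n
    (skipOne<2+n b) (skipOne<2+n b′) (≐-transport (ColumnSet-F b) (ColumnSet-F b′) b≐b′)))

  rows-columns-separated : ∀ a b → ¬ RowSet F a ≐ ColumnSet F b
  rows-columns-separated a b a≐b = offset1-notInRow a (proj₂ row≐arc
    (arc-convex {c′ = toℕ a} {x = 0} (n<1+n (suc n)) (<⇒≤ (skipOne<2+n b))
      (proj₁ row≐arc (offset-inRow a (s≤s z≤n) (λ ()) (λ ())))
      (proj₁ row≐arc (offset-inRow a (s≤s (s≤s 0<n)) (λ ()) 2≢1+n))))
    where
    row≐arc : RowSet F a ≐ Arc (skipOne b) n
    row≐arc = ≐-trans a≐b (ColumnSet-F b)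

  private
    offset0 : ∃ λ b → skipOne b ≡ 0
    offset0 = skipOne-image 0<n (s≤s z≤n) (λ ()) (λ ())

    offset2 : ∃ λ b → skipOne b ≡ 2
    offset2 = skipOne-image 0<n (s≤s (s≤s 0<n)) (λ ()) 2≢1+n

  F-onto : ∀ i → ∃ λ a → ∃ λ b → F a b ≡ i
  F-onto i with toℕ i in i≡ | toℕ<n i
  ... | zero        | _ = F-reaches (fromℕ< 0<n) (proj₁ offset0)
        (trans (cong₂ _+_ (toℕ-fromℕ< 0<n) (proj₂ offset0)) (sym i≡))
  ... | suc zero    | _ = F-reaches (fromℕ< 2≤n) (proj₁ offset0)
        (trans (cong₂ _+_ (toℕ-fromℕ< 2≤n) (proj₂ offset0)) (sym i≡))
  ... | suc (suc t) | 3+t≤2+n = F-reaches (fromℕ< t<n) (proj₁ offset2)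
        (trans (cong₂ _+_ (toℕ-fromℕ< t<n) (proj₂ offset2)) (trans (+-comm t 2) (sym i≡)))
    where
    t<n : t < n
    t<n = s≤s⁻¹ (s≤s⁻¹ 3+t≤2+n)

  hasELC : HasELC (K n n) (2 + n)
  hasELC = LatinRectangle.colouring-hasELC F rows-injective columns-injective F-onto
    (≤-trans 2≤n (m≤m+n n n)) rows-separated columns-separated rows-columns-separated

noELC-≤⊔ : ∀ {p q k} → 2 ≤ p → 2 ≤ q → k ≤ p ⊔ q → ¬ HasELC (K p q) k
noELC-≤⊔ {p} {q} {k} 2≤p@(s≤s (s≤s _)) 2≤q@(s≤s (s≤s _)) k≤p⊔q elc with ≤-total p q
... | inj₁ p≤q = contradiction (Bipartite.leftVertices-identified p q (≤-trans 2≤p (m≤m+n p q)) elc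
                                  (subst (k ≤_) (m≤n⇒m⊔n≡n p≤q) k≤p⊔q) zero (suc zero)) λ ()
... | inj₂ q≤p = contradiction (Bipartite.rightVertices-identified p q (≤-trans 2≤p (m≤m+n p q)) elc
                                  (subst (k ≤_) (m≥n⇒m⊔n≡m q≤p) k≤p⊔q) zero (suc zero)) λ ()

theorem4 : (∀ (n m : ℕ) → 2 ≤ n → 2 ≤ m → n ≢ m
             → EdgeLocatingChromaticIndex (K n m) (suc (n ⊔ m)))
           × (∀ (n : ℕ) → 2 ≤ n → EdgeLocatingChromaticIndex (K n n) (n + 2))
theorem4 = distinctSizes , squareSizes
  where
  distinctSizes : ∀ n m → 2 ≤ n → 2 ≤ m → n ≢ m → EdgeLocatingChromaticIndex (K n m) (suc (n ⊔ m))
  distinctSizes n m 2≤n 2≤m n≢m =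
    DistinctSizes.hasELC n m 2≤n 2≤m n≢m , λ j j<1+n⊔m → noELC-≤⊔ 2≤n 2≤m (s≤s⁻¹ j<1+n⊔m)

  squareSizes : ∀ n → 2 ≤ n → EdgeLocatingChromaticIndex (K n n) (n + 2)
  squareSizes n 2≤n rewrite +-comm n 2 = SquareSizes.hasELC n 2≤n , fewer
    where
    fewer : ∀ j → j < 2 + n → ¬ HasELC (K n n) j
    fewer j j<2+n with m≤n⇒m<n∨m≡n (s≤s⁻¹ j<2+n)
    ... | inj₁ j<1+n = noELC-≤⊔ 2≤n 2≤n (subst (j ≤_) (sym (⊔-idem n)) (s≤s⁻¹ j<1+n))
    ... | inj₂ refl  = square-noELC n 2≤n
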